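{- Let $\alpha$ be a transcendental real number and $f(x)=\lfloor \alpha x\rfloor$ for $x\in\mathbb{Z}$. For all positive integers $m,n$ and all integers $i,j$, the system \[ x\equiv i \pmod m,\qquad f(x)\equiv j \pmod n \] has infinitely many solutions $x\in\mathbb{Z}$.
   Context: $\lfloor\cdot\rfloor$ denotes the floor function. -}

module Defs where

open import Data.Nat using (ℕ)
open import Data.Integer as ℤ using (ℤ; +_; +[1+_]; -[1+_])
open import Data.Rational using (ℚ; 0ℚ; _<_; _+_; _-_; _*_; ∣_∣; _/_)
open import Data.Product using (_×_; ∃)
open import Data.Sum using (_⊎_)
open import Data.List using (List; []; _∷_)
open import Data.List.Relation.Unary.Any using (Any)
open import Relation.Binary.PropositionalEquality using (_≢_)
open import Relation.Nullary using (¬_)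

-- Real numbers as constructive two-sided Dedekind cuts of ℚ.
-- Lower q means q < α, Upper q means α < q.
record ℝ : Set₁ where
  field
    Lower      : ℚ → Set
    Upper      : ℚ → Set
    inhabitedL : ∃ λ q → Lower q
    inhabitedU : ∃ λ q → Upper q
    downL      : ∀ {p q} → p < q → Lower q → Lower p
    upU        : ∀ {p q} → p < q → Upper p → Upper q
    roundedL   : ∀ {q} → Lower q → ∃ λ r → q < r × Lower r
    roundedU   : ∀ {q} → Upper q → ∃ λ r → r < q × Upper r
    disjoint   : ∀ {q} → ¬ (Lower q × Upper q)
    located    : ∀ {p q} → p < q → Lower p ⊎ Upper q
open ℝ public

ℤ→ℚ : ℤ → ℚ
ℤ→ℚ k = k / 1

-- α · x < t   (for an integer x and rational t)
MulLt : ℝ → ℤ → ℚ → Set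
MulLt α (+ 0)      t = 0ℚ < t
MulLt α x@(+[1+ _ ]) t = ∃ λ q → Upper α q × (q * ℤ→ℚ x) < t
MulLt α x@(-[1+ _ ]) t = ∃ λ q → Lower α q × (q * ℤ→ℚ x) < t

IsFloor : ℝ → ℤ → ℤ → Set
IsFloor α x k = ¬ MulLt α x (ℤ→ℚ k) × MulLt α x (ℤ→ℚ (k ℤ.+ + 1))

-- integer polynomials as coefficient lists, lowest degree first
IntPoly : Set
IntPoly = List ℤ

eval : IntPoly → ℚ → ℚ
eval []       q = 0ℚ
eval (c ∷ cs) q = ℤ→ℚ c + q * eval cs q

NonZeroPoly : IntPoly → Set
NonZeroPoly P = Any (λ c → c ≢ + 0) P

-- P(α) = 0 : P takes values arbitrarily close to 0 at rationals
-- arbitrarily close to α (equivalent to P(α) = 0 by continuity of P)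
IsRoot : ℝ → IntPoly → Set
IsRoot α P = ∀ (ε : ℚ) → 0ℚ < ε →
  ∃ λ q → Lower α (q - ε) × Upper α (q + ε) × ∣ eval P q ∣ < ε

Transcendental : ℝ → Set
Transcendental α = ∀ (P : IntPoly) → NonZeroPoly P → ¬ IsRoot α P

{-# OPTIONS --safe #-}
module Submission where

-- For irrational α the function f = ⌊α ·⌋ is additive up to a carry,
-- f (x + y) − f x − f y ∈ {0, 1}, and f y + f (− y) = −1 for y ≠ 0 (α y is never an
-- integer; transcendence is used only in this form).  Pigeonhole on f (d m) mod n,
-- d = 0 … n, then gives s ≠ 0 with m ∣ s and f s ≡ −1 (mod n).  Along x_k = x_0 + k s,
-- all ≡ i (mod m), the integer h k = f (x_k) − k (f s + 1) ≡ f (x_k) (mod n) drops by 0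
-- or 1 at each step, and by at least 1 every L steps, since α s < f s + 1 strictly gives
-- f (L s) ≤ L (f s + 1) − 2 for L large.  So h passes through n consecutive integers
-- and meets the class of j; taking x_0 far out makes |x_k| > N.

open import Defs
open import Data.Nat using (ℕ)
open import Data.Integer using (ℤ; +_; _-_; ∣_∣)
open import Data.Integer.Divisibility using (_∣_)
open import Data.Product using (_×_; ∃)
import Data.Nat as ℕ

open import Data.Nat using (zero; suc)
import Data.Nat.Properties as ℕ
open import Data.Integer as ℤ using (+[1+_]; -[1+_]; _+_; _*_; -_; 0ℤ; 1ℤ; -1ℤ)
import Data.Integer.Properties as ℤ
import Data.Integer.Tactic.RingSolver as ℤ
open import Data.Integer.DivMod using (_%ℕ_; _/ℕ_; a≡a%ℕn+[a/ℕn]*n; n%ℕd<d)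
open import Data.Integer.Divisibility.Signed as Signed using (divides; ∣⇒∣ᵤ) renaming (_∣_ to _∣ₛ_)
open import Data.Rational as ℚ using (ℚ; mkℚ; 0ℚ; 1ℚ; toℚᵘ; _⊔_; _⊓_)
import Data.Rational.Properties as ℚ
open import Data.Rational.Unnormalised as ℚᵘ using (mkℚᵘ; *≡*; *≤*; *<*)
import Data.Rational.Unnormalised.Properties as ℚᵘ
open import Data.Fin using (Fin; toℕ; fromℕ<)
import Data.Fin.Properties as Fin
open import Data.List using ([]; _∷_)
open import Data.List.Relation.Unary.Any using (here; there)
open import Data.Product using (_,_; proj₁; proj₂)
open import Data.Sum using (_⊎_; inj₁; inj₂; [_,_]′)
open import Data.Empty using (⊥-elim)
open import Function using (id; _∘_)
open import Level using (0ℓ)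
open import Relation.Nullary using (¬_; yes; no)
open import Relation.Nullary.Decidable using (dec⇒maybe)
open import Relation.Binary.Definitions using (tri<; tri≈; tri>)
open import Relation.Binary.PropositionalEquality
open import Tactic.RingSolver using (solve-∀)
open import Tactic.RingSolver.Core.AlmostCommutativeRing using (AlmostCommutativeRing; fromCommutativeRing)

toℚᵘ-ℤ→ℚ : ∀ k → toℚᵘ (ℤ→ℚ k) ℚᵘ.≃ mkℚᵘ k 0
toℚᵘ-ℤ→ℚ k = ℚ.toℚᵘ-fromℚᵘ (mkℚᵘ k 0)

ℤ→ℚ-+ : ∀ a b → ℤ→ℚ (a + b) ≡ ℤ→ℚ a ℚ.+ ℤ→ℚ b
ℤ→ℚ-+ a b = ℚ.toℚᵘ-injective (begin-equality
  toℚᵘ (ℤ→ℚ (a + b))                   ≃⟨ toℚᵘ-ℤ→ℚ (a + b) ⟩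
  mkℚᵘ (a + b) 0                        ≃⟨ *≡* (cong (_* 1ℤ) (sym (cong₂ _+_ (ℤ.*-identityʳ a) (ℤ.*-identityʳ b)))) ⟩
  mkℚᵘ a 0 ℚᵘ.+ mkℚᵘ b 0                ≃⟨ ℚᵘ.+-cong (toℚᵘ-ℤ→ℚ a) (toℚᵘ-ℤ→ℚ b) ⟨
  toℚᵘ (ℤ→ℚ a) ℚᵘ.+ toℚᵘ (ℤ→ℚ b)       ≃⟨ ℚ.toℚᵘ-homo-+ (ℤ→ℚ a) (ℤ→ℚ b) ⟨
  toℚᵘ (ℤ→ℚ a ℚ.+ ℤ→ℚ b)               ∎)
  where open ℚᵘ.≤-Reasoning

ℤ→ℚ-* : ∀ a b → ℤ→ℚ (a * b) ≡ ℤ→ℚ a ℚ.* ℤ→ℚ b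
ℤ→ℚ-* a b = ℚ.toℚᵘ-injective (begin-equality
  toℚᵘ (ℤ→ℚ (a * b))                   ≃⟨ toℚᵘ-ℤ→ℚ (a * b) ⟩
  mkℚᵘ a 0 ℚᵘ.* mkℚᵘ b 0                ≃⟨ ℚᵘ.*-cong (toℚᵘ-ℤ→ℚ a) (toℚᵘ-ℤ→ℚ b) ⟨
  toℚᵘ (ℤ→ℚ a) ℚᵘ.* toℚᵘ (ℤ→ℚ b)       ≃⟨ ℚ.toℚᵘ-homo-* (ℤ→ℚ a) (ℤ→ℚ b) ⟨
  toℚᵘ (ℤ→ℚ a ℚ.* ℤ→ℚ b)               ∎)
  where open ℚᵘ.≤-Reasoning

ℤ→ℚ-neg : ∀ a → ℤ→ℚ (- a) ≡ ℚ.- ℤ→ℚ a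
ℤ→ℚ-neg a = ℚ.toℚᵘ-injective (begin-equality
  toℚᵘ (ℤ→ℚ (- a))                     ≃⟨ toℚᵘ-ℤ→ℚ (- a) ⟩
  ℚᵘ.- mkℚᵘ a 0                         ≃⟨ ℚᵘ.-‿cong (toℚᵘ-ℤ→ℚ a) ⟨
  ℚᵘ.- toℚᵘ (ℤ→ℚ a)                    ≃⟨ ℚ.toℚᵘ-homo‿- (ℤ→ℚ a) ⟨
  toℚᵘ (ℚ.- ℤ→ℚ a)                     ∎)
  where open ℚᵘ.≤-Reasoning

ℤ→ℚ-mono-≤ : ∀ {a b} → a ℤ.≤ b → ℤ→ℚ a ℚ.≤ ℤ→ℚ b
ℤ→ℚ-mono-≤ {a} {b} a≤b = ℚ.toℚᵘ-cancel-≤ (begin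
  toℚᵘ (ℤ→ℚ a)  ≃⟨ toℚᵘ-ℤ→ℚ a ⟩
  mkℚᵘ a 0       ≤⟨ *≤* (ℤ.*-monoʳ-≤-nonNeg (+ 1) a≤b) ⟩
  mkℚᵘ b 0       ≃⟨ toℚᵘ-ℤ→ℚ b ⟨
  toℚᵘ (ℤ→ℚ b)  ∎)
  where open ℚᵘ.≤-Reasoning

ℤ→ℚ-mono-< : ∀ {a b} → a ℤ.< b → ℤ→ℚ a ℚ.< ℤ→ℚ b
ℤ→ℚ-mono-< {a} {b} a<b = ℚ.toℚᵘ-cancel-< (begin-strict
  toℚᵘ (ℤ→ℚ a)  ≃⟨ toℚᵘ-ℤ→ℚ a ⟩
  mkℚᵘ a 0       <⟨ *<* (ℤ.*-monoʳ-<-pos (+ 1) a<b) ⟩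
  mkℚᵘ b 0       ≃⟨ toℚᵘ-ℤ→ℚ b ⟨
  toℚᵘ (ℤ→ℚ b)  ∎)
  where open ℚᵘ.≤-Reasoning

ℤ→ℚ-cancel-< : ∀ {a b} → ℤ→ℚ a ℚ.< ℤ→ℚ b → a ℤ.< b
ℤ→ℚ-cancel-< {a} {b} p = ℤ.*-cancelʳ-<-nonNeg (+ 1) (ℚᵘ.drop-*<* (begin-strict
  mkℚᵘ a 0       ≃⟨ toℚᵘ-ℤ→ℚ a ⟨
  toℚᵘ (ℤ→ℚ a)  <⟨ ℚ.toℚᵘ-mono-< p ⟩
  toℚᵘ (ℤ→ℚ b)  ≃⟨ toℚᵘ-ℤ→ℚ b ⟩
  mkℚᵘ b 0       ∎))
  where open ℚᵘ.≤-Reasoning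

archimedean : ∀ δ → 0ℚ ℚ.< δ → ∃ λ M → 1ℚ ℚ.≤ ℤ→ℚ (+ suc M) ℚ.* δ
archimedean δ@(mkℚ n d _) 0<δ = d , ℚ.toℚᵘ-cancel-≤ 1≤[d+1]δ
  where
  1≤n : 1ℤ ℤ.≤ n
  1≤n = ℤ.i<j⇒suc[i]≤j (ℤ.positive⁻¹ n {{ℚ.positive 0<δ}})
  1*[d+1]≤[[d+1]*n]*1 : 1ℤ * + (1 ℕ.* suc d) ℤ.≤ (+ suc d * n) * 1ℤ
  1*[d+1]≤[[d+1]*n]*1 = begin
    1ℤ * + (1 ℕ.* suc d)  ≡⟨ ℤ.*-identityˡ _ ⟩
    + (1 ℕ.* suc d)       ≡⟨ cong +_ (ℕ.*-identityˡ (suc d)) ⟩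
    + suc d               ≡⟨ ℤ.*-identityʳ _ ⟨
    + suc d * 1ℤ          ≤⟨ ℤ.*-monoˡ-≤-nonNeg (+ suc d) 1≤n ⟩
    + suc d * n           ≡⟨ ℤ.*-identityʳ _ ⟨
    (+ suc d * n) * 1ℤ    ∎
    where open ℤ.≤-Reasoning
  1≤[d+1]δ : toℚᵘ 1ℚ ℚᵘ.≤ toℚᵘ (ℤ→ℚ (+ suc d) ℚ.* δ)
  1≤[d+1]δ = begin
    toℚᵘ 1ℚ                           ≤⟨ *≤* 1*[d+1]≤[[d+1]*n]*1 ⟩
    mkℚᵘ (+ suc d) 0 ℚᵘ.* toℚᵘ δ       ≃⟨ ℚᵘ.*-congʳ (toℚᵘ-ℤ→ℚ (+ suc d)) ⟨
    toℚᵘ (ℤ→ℚ (+ suc d)) ℚᵘ.* toℚᵘ δ  ≃⟨ ℚ.toℚᵘ-homo-* (ℤ→ℚ (+ suc d)) δ ⟨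
    toℚᵘ (ℤ→ℚ (+ suc d) ℚ.* δ)        ∎
    where open ℚᵘ.≤-Reasoning

ℤ→ℚ-pos : ∀ k → 0ℚ ℚ.< ℤ→ℚ +[1+ k ]
ℤ→ℚ-pos k = ℤ→ℚ-mono-< {0ℤ} {+[1+ k ]} (ℤ.+<+ (ℕ.s≤s ℕ.z≤n))

p÷q*q≡p : ∀ p q .{{_ : ℚ.NonZero q}} → (p ℚ.÷ q) ℚ.* q ≡ p
p÷q*q≡p p q = begin
  (p ℚ.* ℚ.1/ q) ℚ.* q  ≡⟨ ℚ.*-assoc p (ℚ.1/ q) q ⟩
  p ℚ.* (ℚ.1/ q ℚ.* q)  ≡⟨ cong (p ℚ.*_) (ℚ.*-inverseˡ q) ⟩
  p ℚ.* 1ℚ              ≡⟨ ℚ.*-identityʳ p ⟩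
  p                     ∎
  where open ≡-Reasoning

*-between-< : ∀ {a r b X t} → a ℚ.≤ r → r ℚ.≤ b → a ℚ.* X ℚ.< t → b ℚ.* X ℚ.< t → r ℚ.* X ℚ.< t
*-between-< {a} {r} {b} {X} a≤r r≤b aX<t bX<t with ℚ.≤-total 0ℚ X
... | inj₁ 0≤X = ℚ.≤-<-trans (ℚ.*-monoʳ-≤-nonNeg X {{ℚ.nonNegative 0≤X}} r≤b) bX<t
... | inj₂ X≤0 = ℚ.≤-<-trans (ℚ.*-monoʳ-≤-nonPos X {{ℚ.nonPositive X≤0}} a≤r) aX<t

-- ¬ Lower α q × ¬ Upper α q is how α = q reads for a cut.
transcendental-irrational : ∀ {α} → Transcendental α → ∀ {x c q} → x ≢ 0ℤ →
  q ℚ.* ℤ→ℚ x ≡ ℤ→ℚ c → ¬ (¬ Lower α q × ¬ Upper α q)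
transcendental-irrational {α} tr {x} {c} {q} x≢0 qx≡c (¬lq , ¬uq) = tr ((- c) ∷ x ∷ []) (there (here x≢0)) root
  where
  root : IsRoot α ((- c) ∷ x ∷ [])
  root ε 0<ε = q , q-ε-lower , q+ε-upper , subst (λ v → ℚ.∣ v ∣ ℚ.< ε) (sym eval≡0) 0<ε
    where
    q-ε<q : q ℚ.- ε ℚ.< q
    q-ε<q = subst (q ℚ.- ε ℚ.<_) (ℚ.+-identityʳ q) (ℚ.+-monoʳ-< q (ℚ.neg-antimono-< 0<ε))
    q<q+ε : q ℚ.< q ℚ.+ ε
    q<q+ε = subst (ℚ._< q ℚ.+ ε) (ℚ.+-identityʳ q) (ℚ.+-monoʳ-< q 0<ε)
    q-ε-lower : Lower α (q ℚ.- ε)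
    q-ε-lower = [ id , ⊥-elim ∘ ¬uq ]′ (located α q-ε<q)
    q+ε-upper : Upper α (q ℚ.+ ε)
    q+ε-upper = [ ⊥-elim ∘ ¬lq , id ]′ (located α q<q+ε)
    eval≡0 : eval ((- c) ∷ x ∷ []) q ≡ 0ℚ
    eval≡0 = begin
      ℤ→ℚ (- c) ℚ.+ q ℚ.* (ℤ→ℚ x ℚ.+ q ℚ.* 0ℚ)  ≡⟨ cong (λ v → ℤ→ℚ (- c) ℚ.+ q ℚ.* (ℤ→ℚ x ℚ.+ v)) (ℚ.*-zeroʳ q) ⟩
      ℤ→ℚ (- c) ℚ.+ q ℚ.* (ℤ→ℚ x ℚ.+ 0ℚ)        ≡⟨ cong (λ v → ℤ→ℚ (- c) ℚ.+ q ℚ.* v) (ℚ.+-identityʳ (ℤ→ℚ x)) ⟩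
      ℤ→ℚ (- c) ℚ.+ q ℚ.* ℤ→ℚ x                 ≡⟨ cong₂ ℚ._+_ (ℤ→ℚ-neg c) qx≡c ⟩
      ℚ.- ℤ→ℚ c ℚ.+ ℤ→ℚ c                       ≡⟨ ℚ.+-inverseˡ (ℤ→ℚ c) ⟩
      0ℚ                                         ∎
      where open ≡-Reasoning

ℚ-ring : AlmostCommutativeRing 0ℓ 0ℓ
ℚ-ring = fromCommutativeRing ℚ.+-*-commutativeRing (λ q → dec⇒maybe (0ℚ ℚ.≟ q))

module Multiples (α : ℝ) where

  lower<upper : ∀ {p q} → Lower α p → Upper α q → p ℚ.< q
  lower<upper {p} {q} lp uq with ℚ.<-cmp p q
  ... | tri< p<q _ _  = p<q
  ... | tri≈ _ refl _ = ⊥-elim (disjoint α (lp , uq))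
  ... | tri> _ _ q<p  = ⊥-elim (disjoint α (downL α q<p lp , uq))

  Lower-⊔ : ∀ {p q} → Lower α p → Lower α q → Lower α (p ⊔ q)
  Lower-⊔ {p} {q} lp lq =
    [ (λ e → subst (Lower α) (sym e) lp) , (λ e → subst (Lower α) (sym e) lq) ]′ (ℚ.⊔-sel p q)

  Upper-⊓ : ∀ {p q} → Upper α p → Upper α q → Upper α (p ⊓ q)
  Upper-⊓ {p} {q} up uq =
    [ (λ e → subst (Upper α) (sym e) up) , (λ e → subst (Upper α) (sym e) uq) ]′ (ℚ.⊓-sel p q)

  -- α x < t, witnessed by an interval around α on which r ↦ r x stays below t;
  -- using both endpoints spares a case split on the sign of x.
  infix 4 _·α<_
  record _·α<_ (x : ℤ) (t : ℚ) : Set where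
    constructor bracket
    field
      lo hi  : ℚ
      lower  : Lower α lo
      upper  : Upper α hi
      lo·x<t : lo ℚ.* ℤ→ℚ x ℚ.< t
      hi·x<t : hi ℚ.* ℤ→ℚ x ℚ.< t

    within : ∀ {r} → lo ℚ.≤ r → r ℚ.≤ hi → r ℚ.* ℤ→ℚ x ℚ.< t
    within lo≤r r≤hi = *-between-< lo≤r r≤hi lo·x<t hi·x<t

  open _·α<_

  ·α<-weaken : ∀ {x s t} → x ·α< s → s ℚ.≤ t → x ·α< t
  ·α<-weaken (bracket a b la ub p q) s≤t = bracket a b la ub (ℚ.<-≤-trans p s≤t) (ℚ.<-≤-trans q s≤t)

  ·α<-+ : ∀ {x y s t} → x ·α< s → y ·α< t → (x + y) ·α< (s ℚ.+ t)
  ·α<-+ {x} {y} {s} {t} v w = bracket A B lA uB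
    (at (ℚ.p≤p⊔q (lo v) (lo w)) (ℚ.p≤q⊔p (lo v) (lo w)) (A≤ (upper v)) (A≤ (upper w)))
    (at (≤B (lower v)) (≤B (lower w)) (ℚ.p⊓q≤p (hi v) (hi w)) (ℚ.p⊓q≤q (hi v) (hi w)))
    where
    A = lo v ⊔ lo w
    B = hi v ⊓ hi w
    lA : Lower α A
    lA = Lower-⊔ (lower v) (lower w)
    uB : Upper α B
    uB = Upper-⊓ (upper v) (upper w)
    A≤ : ∀ {q} → Upper α q → A ℚ.≤ q
    A≤ uq = ℚ.<⇒≤ (lower<upper lA uq)
    ≤B : ∀ {p} → Lower α p → p ℚ.≤ B
    ≤B lp = ℚ.<⇒≤ (lower<upper lp uB)
    at : ∀ {r} → lo v ℚ.≤ r → lo w ℚ.≤ r → r ℚ.≤ hi v → r ℚ.≤ hi w →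
         r ℚ.* ℤ→ℚ (x + y) ℚ.< s ℚ.+ t
    at {r} p₁ p₂ p₃ p₄ rewrite ℤ→ℚ-+ x y | ℚ.*-distribˡ-+ r (ℤ→ℚ x) (ℤ→ℚ y) =
      ℚ.+-mono-< (within v p₁ p₃) (within w p₂ p₄)

  ·α<-round : ∀ {x t} → x ·α< t → ∃ λ t′ → t′ ℚ.< t × x ·α< t′
  ·α<-round {x} (bracket a b la ub aX<t bX<t) with ℚ.≤-total (a ℚ.* ℤ→ℚ x) (b ℚ.* ℤ→ℚ x)
  ... | inj₁ aX≤bX = let t′ , bX<t′ , t′<t = ℚ.<-dense bX<t in
    t′ , t′<t , bracket a b la ub (ℚ.≤-<-trans aX≤bX bX<t′) bX<t′
  ... | inj₂ bX≤aX = let t′ , aX<t′ , t′<t = ℚ.<-dense aX<t in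
    t′ , t′<t , bracket a b la ub aX<t′ (ℚ.≤-<-trans bX≤aX aX<t′)

  0·α<⇒0< : ∀ {t} → 0ℤ ·α< t → 0ℚ ℚ.< t
  0·α<⇒0< {t} w = subst (ℚ._< t) (ℚ.*-zeroʳ (lo w)) (lo·x<t w)

  MulLt⇒·α< : ∀ {x t} → MulLt α x t → x ·α< t
  MulLt⇒·α< {+ 0} {t} 0<t =
    let a , la = inhabitedL α ; b , ub = inhabitedU α
    in bracket a b la ub (subst (ℚ._< t) (sym (ℚ.*-zeroʳ a)) 0<t) (subst (ℚ._< t) (sym (ℚ.*-zeroʳ b)) 0<t)
  MulLt⇒·α< {x@(+[1+ k ])} (b , ub , bX<t) =
    let a , la = inhabitedL α
        aX≤bX = ℚ.*-monoʳ-≤-nonNeg (ℤ→ℚ x) {{ℚ.nonNegative (ℚ.<⇒≤ (ℤ→ℚ-pos k))}}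
                  (ℚ.<⇒≤ (lower<upper la ub))
    in bracket a b la ub (ℚ.≤-<-trans aX≤bX bX<t) bX<t
  MulLt⇒·α< {x@(-[1+ k ])} (a , la , aX<t) =
    let b , ub = inhabitedU α
        bX≤aX = ℚ.*-monoʳ-≤-nonPos (ℤ→ℚ x) {{ℚ.nonPositive (ℤ→ℚ-mono-≤ {x} {0ℤ} ℤ.-≤+)}}
                  (ℚ.<⇒≤ (lower<upper la ub))
    in bracket a b la ub aX<t (ℚ.≤-<-trans bX≤aX aX<t)

  ·α<⇒MulLt : ∀ {x t} → x ·α< t → MulLt α x t
  ·α<⇒MulLt {+ 0}      w = 0·α<⇒0< w
  ·α<⇒MulLt {+[1+ _ ]} w = hi w , upper w , hi·x<t w
  ·α<⇒MulLt { -[1+ _ ]} w = lo w , lower w , lo·x<t w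

  ≮·α<-< : ∀ {x a b} → ¬ x ·α< ℤ→ℚ a → x ·α< ℤ→ℚ b → a ℤ.< b
  ≮·α<-< {a = a} {b} x≮a x<b with a ℤ.<? b
  ... | yes a<b = a<b
  ... | no  a≮b = ⊥-elim (x≮a (·α<-weaken x<b (ℤ→ℚ-mono-≤ (ℤ.≮⇒≥ a≮b))))

  ·α<-scale : ∀ M {x t} → x ·α< t → (+ suc M * x) ·α< (ℤ→ℚ (+ suc M) ℚ.* t)
  ·α<-scale zero    {x} {t} w = subst₂ _·α<_ (sym (ℤ.*-identityˡ x)) (sym (ℚ.*-identityˡ t)) w
  ·α<-scale (suc M) {x} {t} w =
    subst₂ _·α<_ (sym (ℤ.suc-* (+ suc M) x)) (sym [2+M]t≡t+[1+M]t) (·α<-+ w (·α<-scale M w))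
    where
    [2+M]t≡t+[1+M]t : ℤ→ℚ (+ suc (suc M)) ℚ.* t ≡ t ℚ.+ ℤ→ℚ (+ suc M) ℚ.* t
    [2+M]t≡t+[1+M]t = begin
      ℤ→ℚ (1ℤ + + suc M) ℚ.* t                  ≡⟨ cong (ℚ._* t) (ℤ→ℚ-+ 1ℤ (+ suc M)) ⟩
      (1ℚ ℚ.+ ℤ→ℚ (+ suc M)) ℚ.* t             ≡⟨ ℚ.*-distribʳ-+ t 1ℚ (ℤ→ℚ (+ suc M)) ⟩
      1ℚ ℚ.* t ℚ.+ ℤ→ℚ (+ suc M) ℚ.* t         ≡⟨ cong (ℚ._+ ℤ→ℚ (+ suc M) ℚ.* t) (ℚ.*-identityˡ t) ⟩
      t ℚ.+ ℤ→ℚ (+ suc M) ℚ.* t                ∎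
      where open ≡-Reasoning

  module _ (k : ℕ) where
    private
      X = ℤ→ℚ +[1+ k ]
      instance
        X-positive : ℚ.Positive X
        X-positive = ℚ.positive (ℤ→ℚ-pos k)
        X-nonZero : ℚ.NonZero X
        X-nonZero = ℚ.pos⇒nonZero X

    Upper⇒·α< : ∀ {q} → Upper α q → +[1+ k ] ·α< (q ℚ.* X)
    Upper⇒·α< uq = let r , r<q , ur = roundedU α uq in MulLt⇒·α< (r , ur , ℚ.*-monoˡ-<-pos X r<q)

    Lower⇒-·α< : ∀ {q} → Lower α q → -[1+ k ] ·α< ℚ.- (q ℚ.* X)
    Lower⇒-·α< {q} lq = let r , q<r , lr = roundedL α lq in MulLt⇒·α< (r , lr , (begin-strict
      r ℚ.* ℤ→ℚ -[1+ k ]  ≡⟨ cong (r ℚ.*_) (ℤ→ℚ-neg +[1+ k ]) ⟩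
      r ℚ.* ℚ.- X          ≡⟨ ℚ.neg-distribʳ-* r X ⟨
      ℚ.- (r ℚ.* X)        <⟨ ℚ.neg-antimono-< (ℚ.*-monoˡ-<-pos X q<r) ⟩
      ℚ.- (q ℚ.* X)        ∎))
      where open ℚ.≤-Reasoning

    ÷X-mono-< : ∀ {s t} → s ℚ.< t → s ℚ.÷ X ℚ.< t ℚ.÷ X
    ÷X-mono-< {s} {t} s<t =
      ℚ.*-cancelʳ-<-nonNeg X {{ℚ.pos⇒nonNeg X}} (subst₂ ℚ._<_ (sym (p÷q*q≡p s X)) (sym (p÷q*q≡p t X)) s<t)

    +·α<-located : ∀ {s t} → s ℚ.< t → +[1+ k ] ·α< t ⊎ -[1+ k ] ·α< ℚ.- s
    +·α<-located {s} {t} s<t =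
      [ (λ l → inj₂ (subst (λ u → -[1+ k ] ·α< ℚ.- u) (p÷q*q≡p s X) (Lower⇒-·α< l)))
      , (λ u → inj₁ (subst (+[1+ k ] ·α<_) (p÷q*q≡p t X) (Upper⇒·α< u)))
      ]′ (located α (÷X-mono-< s<t))

    +·α<-apart : Transcendental α → ∀ c → ¬ (¬ +[1+ k ] ·α< ℤ→ℚ c × ¬ -[1+ k ] ·α< ℤ→ℚ (- c))
    +·α<-apart tr c (≮c , ≮-c) =
      transcendental-irrational {α} tr {+[1+ k ]} {c} {q} (λ ()) (p÷q*q≡p (ℤ→ℚ c) X) (¬lower , ¬upper)
      where
      q = ℤ→ℚ c ℚ.÷ X
      ¬upper : ¬ Upper α q
      ¬upper u = ≮c (subst (+[1+ k ] ·α<_) (p÷q*q≡p (ℤ→ℚ c) X) (Upper⇒·α< u))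
      ¬lower : ¬ Lower α q
      ¬lower l = ≮-c (subst (-[1+ k ] ·α<_) (trans (cong ℚ.-_ (p÷q*q≡p (ℤ→ℚ c) X)) (sym (ℤ→ℚ-neg c)))
                            (Lower⇒-·α< l))

  -- - x ·α< ℚ.- s reads α x > s.
  ·α<-located : ∀ x {s t} → s ℚ.< t → x ·α< t ⊎ - x ·α< ℚ.- s
  ·α<-located (+ 0) {s} {t} s<t with 0ℚ ℚ.<? t
  ... | yes 0<t = inj₁ (MulLt⇒·α< 0<t)
  ... | no  0≮t = inj₂ (MulLt⇒·α< (ℚ.neg-antimono-< (ℚ.<-≤-trans s<t (ℚ.≮⇒≥ 0≮t))))
  ·α<-located +[1+ k ] s<t = +·α<-located k s<t
  ·α<-located -[1+ k ] {s} {t} s<t =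
    [ inj₂ , inj₁ ∘ subst (-[1+ k ] ·α<_) (neg-involutive t) ]′ (+·α<-located k (ℚ.neg-antimono-< s<t))
    where
    neg-involutive : ∀ t → ℚ.- (ℚ.- t) ≡ t
    neg-involutive = solve-∀ ℚ-ring

  ·α<-apart : Transcendental α → ∀ {x} → x ≢ 0ℤ → ∀ c →
              ¬ (¬ x ·α< ℤ→ℚ c × ¬ - x ·α< ℤ→ℚ (- c))
  ·α<-apart tr {+ 0}       x≢0 c _ = x≢0 refl
  ·α<-apart tr {+[1+ k ]} _   c   = +·α<-apart k tr c
  ·α<-apart tr { -[1+ k ]} _  c (≮c , ≮-c) =
    +·α<-apart k tr (- c) (≮-c , subst (λ v → ¬ -[1+ k ] ·α< ℤ→ℚ v) (sym (ℤ.neg-involutive c)) ≮c)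

  ≮·α<-+ : ∀ {x y s t} → ¬ x ·α< s → ¬ y ·α< t → ¬ x + y ·α< s ℚ.+ t
  ≮·α<-+ {x} {y} {s} {t} x≮s y≮t x+y<s+t = let u , u<s+t , x+y<u = ·α<-round x+y<s+t in split u<s+t x+y<u
    where
    [x+y]-y≡x : ∀ x y → x + y + - y ≡ x
    [x+y]-y≡x = ℤ.solve-∀
    u-[u-s]≡s : ∀ u s → u ℚ.+ ℚ.- (u ℚ.- s) ≡ s
    u-[u-s]≡s = solve-∀ ℚ-ring
    [s+t]-s≡t : ∀ s t → (s ℚ.+ t) ℚ.- s ≡ t
    [s+t]-s≡t = solve-∀ ℚ-ring
    split : ∀ {u} → u ℚ.< s ℚ.+ t → ¬ x + y ·α< u
    split {u} u<s+t x+y<u =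
      [ y≮t
      , (λ -y<s-u → x≮s (subst₂ _·α<_ ([x+y]-y≡x x y) (u-[u-s]≡s u s) (·α<-+ x+y<u -y<s-u)))
      ]′ (·α<-located y (subst (u ℚ.- s ℚ.<_) ([s+t]-s≡t s t) (ℚ.+-monoˡ-< (ℚ.- s) u<s+t)))

  ·α<-gap : ∀ {s} c → s ·α< ℤ→ℚ c → ∃ λ M → + suc M * s ·α< ℤ→ℚ (+ suc M * c - 1ℤ)
  ·α<-gap {s} c s<c =
    let t , t<C , s<t = ·α<-round s<c
        M , 1≤Kδ      = archimedean (C ℚ.- t) (0<C-t t<C)
    in M , ·α<-weaken (·α<-scale M s<t) (bound M t 1≤Kδ)
    where
    C = ℤ→ℚ c
    0<C-t : ∀ {t} → t ℚ.< C → 0ℚ ℚ.< C ℚ.- t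
    0<C-t {t} t<C = subst (ℚ._< C ℚ.- t) (ℚ.+-inverseʳ t) (ℚ.+-monoˡ-< (ℚ.- t) t<C)
    Kt≡KC-K[C-t] : ∀ K C t → K ℚ.* t ≡ K ℚ.* C ℚ.- K ℚ.* (C ℚ.- t)
    Kt≡KC-K[C-t] = solve-∀ ℚ-ring
    bound : ∀ M t → 1ℚ ℚ.≤ ℤ→ℚ (+ suc M) ℚ.* (C ℚ.- t) →
            ℤ→ℚ (+ suc M) ℚ.* t ℚ.≤ ℤ→ℚ (+ suc M * c - 1ℤ)
    bound M t 1≤Kδ = begin
      K ℚ.* t                          ≡⟨ Kt≡KC-K[C-t] K C t ⟩
      K ℚ.* C ℚ.- K ℚ.* (C ℚ.- t)      ≤⟨ ℚ.+-monoʳ-≤ (K ℚ.* C) (ℚ.neg-antimono-≤ 1≤Kδ) ⟩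
      K ℚ.* C ℚ.- 1ℚ                   ≡⟨ cong₂ ℚ._+_ (ℤ→ℚ-* (+ suc M) c) (ℤ→ℚ-neg 1ℤ) ⟨
      ℤ→ℚ (+ suc M * c) ℚ.+ ℤ→ℚ -1ℤ   ≡⟨ ℤ→ℚ-+ (+ suc M * c) -1ℤ ⟨
      ℤ→ℚ (+ suc M * c - 1ℤ)          ∎
      where
      K = ℤ→ℚ (+ suc M)
      open ℚ.≤-Reasoning

<-suc⇒≤ : ∀ {a b} → a ℤ.< b + 1ℤ → a ℤ.≤ b
<-suc⇒≤ {a} {b} a<b+1 = subst (a ℤ.≤_) (pred-[b+1]≡b b) (ℤ.i<j⇒i≤pred[j] a<b+1)
  where
  pred-[b+1]≡b : ∀ b → -1ℤ + (b + 1ℤ) ≡ b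
  pred-[b+1]≡b = ℤ.solve-∀

≤-≤-suc⇒≡⊎≡suc : ∀ {a b} → a ℤ.≤ b → b ℤ.≤ a + 1ℤ → b ≡ a ⊎ b ≡ a + 1ℤ
≤-≤-suc⇒≡⊎≡suc {a} {b} a≤b b≤a+1 with b ℤ.≟ a
... | yes b≡a = inj₁ b≡a
... | no  b≢a = inj₂ (ℤ.≤-antisym b≤a+1 a+1≤b)
  where
  a+1≤b : a + 1ℤ ℤ.≤ b
  a+1≤b = subst (ℤ._≤ b) (ℤ.+-comm 1ℤ a) (ℤ.i<j⇒suc[i]≤j (ℤ.≤∧≢⇒< a≤b (b≢a ∘ sym)))

Carry : (ℤ → ℤ) → Set
Carry f = ∀ x y → f (x + y) ≡ f x + f y ⊎ f (x + y) ≡ f x + f y + 1ℤ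

module Floor {α : ℝ} (tr : Transcendental α) {f : ℤ → ℤ} (isFloor : ∀ x → IsFloor α x (f x)) where
  open Multiples α

  floor-≤ : ∀ x → ¬ x ·α< ℤ→ℚ (f x)
  floor-≤ x = proj₁ (isFloor x) ∘ ·α<⇒MulLt

  floor-> : ∀ x → x ·α< ℤ→ℚ (f x + 1ℤ)
  floor-> x = MulLt⇒·α< (proj₂ (isFloor x))

  floor-0 : f 0ℤ ≡ 0ℤ
  floor-0 = ℤ.≤-antisym
    (ℤ.≮⇒≥ (λ 0<f0 → proj₁ (isFloor 0ℤ) (ℤ→ℚ-mono-< {0ℤ} 0<f0)))
    (<-suc⇒≤ (ℤ→ℚ-cancel-< {0ℤ} (proj₂ (isFloor 0ℤ))))

  floor-+-≤ : ∀ x y → f x + f y ℤ.≤ f (x + y)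
  floor-+-≤ x y = <-suc⇒≤ (≮·α<-< x+y≮fx+fy (floor-> (x + y)))
    where
    x+y≮fx+fy : ¬ x + y ·α< ℤ→ℚ (f x + f y)
    x+y≮fx+fy rewrite ℤ→ℚ-+ (f x) (f y) = ≮·α<-+ (floor-≤ x) (floor-≤ y)

  floor-+-≤-suc : ∀ x y → f (x + y) ℤ.≤ f x + f y + 1ℤ
  floor-+-≤-suc x y =
    <-suc⇒≤ (subst (f (x + y) ℤ.<_) (regroup (f x) (f y)) (≮·α<-< (floor-≤ (x + y)) x+y<fx+fy+2))
    where
    x+y<fx+fy+2 : x + y ·α< ℤ→ℚ ((f x + 1ℤ) + (f y + 1ℤ))
    x+y<fx+fy+2 rewrite ℤ→ℚ-+ (f x + 1ℤ) (f y + 1ℤ) = ·α<-+ (floor-> x) (floor-> y)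
    regroup : ∀ a b → (a + 1ℤ) + (b + 1ℤ) ≡ a + b + 1ℤ + 1ℤ
    regroup = ℤ.solve-∀

  f[y-y]≡0 : ∀ y → f (y + - y) ≡ 0ℤ
  f[y-y]≡0 y = trans (cong f (ℤ.+-inverseʳ y)) floor-0

  floor-carry : Carry f
  floor-carry x y = ≤-≤-suc⇒≡⊎≡suc (floor-+-≤ x y) (floor-+-≤-suc x y)

  floor-odd : ∀ y → y ≢ 0ℤ → f y + f (- y) ≡ -1ℤ
  floor-odd y y≢0 with floor-carry y (- y)
  ... | inj₁ f0≡fy+f-y =
    ⊥-elim (·α<-apart tr y≢0 (f y) (floor-≤ y , subst (λ v → ¬ - y ·α< ℤ→ℚ v) f-y≡-fy (floor-≤ (- y))))
    where
    b≡-a+[a+b] : ∀ a b → b ≡ - a + (a + b)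
    b≡-a+[a+b] = ℤ.solve-∀
    f-y≡-fy : f (- y) ≡ - f y
    f-y≡-fy = begin
      f (- y)                ≡⟨ b≡-a+[a+b] (f y) (f (- y)) ⟩
      - f y + (f y + f (- y)) ≡⟨ cong (λ v → - f y + v) (trans (sym f0≡fy+f-y) (f[y-y]≡0 y)) ⟩
      - f y + 0ℤ              ≡⟨ ℤ.+-identityʳ (- f y) ⟩
      - f y                   ∎
      where open ≡-Reasoning
  ... | inj₂ f0≡fy+f-y+1 = begin
      f y + f (- y)               ≡⟨ b≡[b+1]-1 (f y + f (- y)) ⟩
      (f y + f (- y) + 1ℤ) - 1ℤ   ≡⟨ cong (_- 1ℤ) (trans (sym f0≡fy+f-y+1) (f[y-y]≡0 y)) ⟩
      0ℤ - 1ℤ                     ∎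
    where
    open ≡-Reasoning
    b≡[b+1]-1 : ∀ b → b ≡ (b + 1ℤ) - 1ℤ
    b≡[b+1]-1 = ℤ.solve-∀

  floor-gap : ∀ s → ∃ λ M → f (+ suc M * s) ℤ.≤ + suc M * (f s + 1ℤ) - + 2
  floor-gap s =
    let M , Ls<Lc-1 = ·α<-gap (f s + 1ℤ) (floor-> s)
    in M , <-suc⇒≤ (subst (f (+ suc M * s) ℤ.<_) (a-1≡a-2+1 (+ suc M * (f s + 1ℤ)))
                          (≮·α<-< (floor-≤ (+ suc M * s)) Ls<Lc-1))
    where
    a-1≡a-2+1 : ∀ a → a - 1ℤ ≡ a - + 2 + 1ℤ
    a-1≡a-2+1 = ℤ.solve-∀

DescendsByUnitSteps : (ℕ → ℤ) → Set
DescendsByUnitSteps h = ∀ k → h (suc k) ≡ h k ⊎ h (suc k) ≡ h k - 1ℤ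

intermediate-value : ∀ (h : ℕ → ℤ) → DescendsByUnitSteps h →
                     ∀ K {v} → h K ℤ.≤ v → v ℤ.≤ h 0 → ∃ λ k → h k ≡ v
intermediate-value h step zero    hK≤v v≤h0 = 0 , ℤ.≤-antisym hK≤v v≤h0
intermediate-value h step (suc K) {v} hK+1≤v v≤h0 with step K
... | inj₁ e = intermediate-value h step K (subst (ℤ._≤ v) e hK+1≤v) v≤h0
... | inj₂ e with h K ℤ.≤? v
...   | yes hK≤v = intermediate-value h step K hK≤v v≤h0
...   | no  hK≰v = suc K , ℤ.≤-antisym hK+1≤v (subst (v ℤ.≤_) (sym e) v≤hK-1)
  where
  v≤hK-1 : v ℤ.≤ h K - 1ℤ
  v≤hK-1 = subst (v ℤ.≤_) (ℤ.+-comm -1ℤ (h K)) (ℤ.i<j⇒i≤pred[j] (ℤ.≰⇒> hK≰v))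

periodic-descent : ∀ (h : ℕ → ℤ) L → (∀ k → h (k ℕ.+ L) + 1ℤ ℤ.≤ h k) →
                   ∀ J → h (J ℕ.* L) + + J ℤ.≤ h 0
periodic-descent h L drop zero    = ℤ.≤-reflexive (ℤ.+-identityʳ (h 0))
periodic-descent h L drop (suc J) = begin
  h (L ℕ.+ J ℕ.* L) + + suc J        ≡⟨ cong (λ k → h k + + suc J) (ℕ.+-comm L (J ℕ.* L)) ⟩
  h (J ℕ.* L ℕ.+ L) + (1ℤ + + J)     ≡⟨ ℤ.+-assoc (h (J ℕ.* L ℕ.+ L)) 1ℤ (+ J) ⟨
  h (J ℕ.* L ℕ.+ L) + 1ℤ + + J       ≤⟨ ℤ.+-monoˡ-≤ (+ J) (drop (J ℕ.* L)) ⟩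
  h (J ℕ.* L) + + J                  ≤⟨ periodic-descent h L drop J ⟩
  h 0                                ∎
  where open ℤ.≤-Reasoning

∣-[a-a%ℕn] : ∀ a n .{{_ : ℕ.NonZero n}} → + n ∣ₛ a - + (a %ℕ n)
∣-[a-a%ℕn] a n = divides (a /ℕ n) (begin
  a - + (a %ℕ n)                               ≡⟨ cong (_- + (a %ℕ n)) (a≡a%ℕn+[a/ℕn]*n a n) ⟩
  + (a %ℕ n) + (a /ℕ n) * + n - + (a %ℕ n)     ≡⟨ [r+q]-r≡q (+ (a %ℕ n)) ((a /ℕ n) * + n) ⟩
  (a /ℕ n) * + n                               ∎)
  where
  open ≡-Reasoning
  [r+q]-r≡q : ∀ r q → r + q - r ≡ q
  [r+q]-r≡q = ℤ.solve-∀

%ℕ-≡⇒∣- : ∀ {a b} n .{{_ : ℕ.NonZero n}} → a %ℕ n ≡ b %ℕ n → + n ∣ₛ b - a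
%ℕ-≡⇒∣- {a} {b} n a≡b = subst (+ n ∣ₛ_) (regroup b a (+ (a %ℕ n)))
  (Signed.∣m∣n⇒∣m-n (subst (λ r → + n ∣ₛ b - + r) (sym a≡b) (∣-[a-a%ℕn] b n)) (∣-[a-a%ℕn] a n))
  where
  regroup : ∀ b a r → (b - r) - (a - r) ≡ b - a
  regroup = ℤ.solve-∀

[i+j]-i≡j : ∀ i j → i + j - i ≡ j
[i+j]-i≡j = ℤ.solve-∀

N<∣i+t*s∣ : ∀ N i t s → s ≢ 0ℤ → N ℕ.+ ∣ i ∣ ℕ.< t → N ℕ.< ∣ i + + t * s ∣
N<∣i+t*s∣ N i t s s≢0 N+∣i∣<t = ℕ.+-cancelʳ-< (∣ i ∣) N (∣ i + + t * s ∣) (begin-strict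
  N ℕ.+ ∣ i ∣                   <⟨ N+∣i∣<t ⟩
  t                             ≤⟨ ℕ.m≤m*n t (∣ s ∣) {{∣s∣≢0}} ⟩
  t ℕ.* ∣ s ∣                   ≡⟨ ℤ.abs-* (+ t) s ⟨
  ∣ + t * s ∣                   ≡⟨ cong ∣_∣ ([i+j]-i≡j i (+ t * s)) ⟨
  ∣ i + + t * s - i ∣           ≤⟨ ℤ.∣i-j∣≤∣i∣+∣j∣ (i + + t * s) i ⟩
  ∣ i + + t * s ∣ ℕ.+ ∣ i ∣     ∎)
  where
  open ℕ.≤-Reasoning
  ∣s∣≢0 : ℕ.NonZero ∣ s ∣
  ∣s∣≢0 = ℕ.≢-nonZero (s≢0 ∘ ℤ.∣i∣≡0⇒i≡0)

module Residues {f : ℤ → ℤ} (carry : Carry f) (odd : ∀ y → y ≢ 0ℤ → f y + f (- y) ≡ -1ℤ)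
  (gap : ∀ s → ∃ λ M → f (+ suc M * s) ℤ.≤ + suc M * (f s + 1ℤ) - + 2) where

  carry-≤ : ∀ x y → f (x + y) ℤ.≤ f x + f y + 1ℤ
  carry-≤ x y with carry x y
  ... | inj₁ e = subst (ℤ._≤ f x + f y + 1ℤ) (sym e) (ℤ.i≤i+j (f x + f y) 1ℤ)
  ... | inj₂ e = ℤ.≤-reflexive e

  module _ (m n : ℕ) .{{_ : ℕ.NonZero m}} .{{_ : ℕ.NonZero n}} where

    step-from-collision : ∀ {u v} → u ≢ 0ℤ → + m ∣ₛ u → + n ∣ₛ f (u + v) - f v →
                          ∃ λ s → s ≢ 0ℤ × + m ∣ₛ s × + n ∣ₛ f s + 1ℤ
    step-from-collision {u} {v} u≢0 m∣u n∣Δ with carry u v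
    ... | inj₂ e = u , u≢0 , m∣u , subst (+ n ∣ₛ_) (trans (cong (_- f v) e) ([a+b+1]-b≡a+1 (f u) (f v))) n∣Δ
      where
      [a+b+1]-b≡a+1 : ∀ a b → a + b + 1ℤ - b ≡ a + 1ℤ
      [a+b+1]-b≡a+1 = ℤ.solve-∀
    ... | inj₁ e =
      - u , u≢0 ∘ ℤ.neg-injective , Signed.∣m⇒∣-m m∣u , subst (+ n ∣ₛ_) (sym f-u+1≡-fu) (Signed.∣m⇒∣-m n∣fu)
      where
      [a+b]-b≡a : ∀ a b → a + b - b ≡ a
      [a+b]-b≡a = ℤ.solve-∀
      n∣fu : + n ∣ₛ f u
      n∣fu = subst (+ n ∣ₛ_) (trans (cong (_- f v) e) ([a+b]-b≡a (f u) (f v))) n∣Δ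
      b+1≡-a+[[a+b]+1] : ∀ a b → b + 1ℤ ≡ - a + (a + b + 1ℤ)
      b+1≡-a+[[a+b]+1] = ℤ.solve-∀
      f-u+1≡-fu : f (- u) + 1ℤ ≡ - f u
      f-u+1≡-fu = begin
        f (- u) + 1ℤ                 ≡⟨ b+1≡-a+[[a+b]+1] (f u) (f (- u)) ⟩
        - f u + (f u + f (- u) + 1ℤ) ≡⟨ cong (λ w → - f u + (w + 1ℤ)) (odd u u≢0) ⟩
        - f u + 0ℤ                   ≡⟨ ℤ.+-identityʳ (- f u) ⟩
        - f u                        ∎
        where open ≡-Reasoning

    step-exists : ∃ λ s → s ≢ 0ℤ × + m ∣ₛ s × + n ∣ₛ f s + 1ℤ
    step-exists =
      let d₁ , d₂ , d₁<d₂ , same = Fin.pigeonhole (ℕ.n<1+n n) residue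
      in collision d₁<d₂ (trans (sym (Fin.toℕ-fromℕ< _)) (trans (cong toℕ same) (Fin.toℕ-fromℕ< _)))
      where
      residue : Fin (suc n) → Fin n
      residue d = fromℕ< (n%ℕd<d (f (+ toℕ d * + m)) n)
      collision : ∀ {a b} → a ℕ.< b → f (+ a * + m) %ℕ n ≡ f (+ b * + m) %ℕ n →
                  ∃ λ s → s ≢ 0ℤ × + m ∣ₛ s × + n ∣ₛ f s + 1ℤ
      collision {a} {b} a<b same = step-from-collision u≢0 (Signed.∣n⇒∣m*n (+ e) Signed.∣-refl) n∣Δ
        where
        e = b ℕ.∸ a
        u = + e * + m
        v = + a * + m
        instance
          e≢0 : ℕ.NonZero e
          e≢0 = ℕ.>-nonZero (ℕ.m<n⇒0<n∸m a<b)
        u≢0 : u ≢ 0ℤ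
        u≢0 u≡0 = ℕ.≢-nonZero⁻¹ (e ℕ.* m) {{ℕ.m*n≢0 e m}} (ℤ.+-injective (trans (ℤ.pos-* e m) u≡0))
        bm≡u+v : + b * + m ≡ u + v
        bm≡u+v = trans (cong (λ t → + t * + m) (sym (ℕ.m∸n+n≡m (ℕ.<⇒≤ a<b))))
                       (ℤ.*-distribʳ-+ (+ m) (+ e) (+ a))
        n∣Δ : + n ∣ₛ f (u + v) - f v
        n∣Δ = subst (λ w → + n ∣ₛ f w - f v) bm≡u+v (%ℕ-≡⇒∣- {f v} {f (+ b * + m)} n same)

    module Walk (i j : ℤ) (N : ℕ) {s} (s≢0 : s ≢ 0ℤ) (m∣s : + m ∣ₛ s) (n∣c : + n ∣ₛ f s + 1ℤ) where

      c = f s + 1ℤ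
      B = suc (N ℕ.+ ∣ i ∣)
      L = suc (proj₁ (gap s))

      x : ℕ → ℤ
      x k = i + + (B ℕ.+ k) * s

      h : ℕ → ℤ
      h k = f (x k) - + k * c

      x-suc : ∀ k → x (suc k) ≡ s + x k
      x-suc k = shift i (+ B) (+ k) s
        where
        shift : ∀ i b k s → i + (b + (1ℤ + k)) * s ≡ s + (i + (b + k) * s)
        shift = ℤ.solve-∀

      h-step : DescendsByUnitSteps h
      h-step k with carry s (x k)
      ... | inj₁ e = inj₂ (begin
        f (x (suc k)) - + suc k * c          ≡⟨ cong (λ y → f y - + suc k * c) (x-suc k) ⟩
        f (s + x k) - + suc k * c            ≡⟨ cong (_- + suc k * c) e ⟩
        f s + f (x k) - + suc k * c          ≡⟨ no-carry (f s) (f (x k)) (+ k) ⟩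
        h k - 1ℤ                             ∎)
        where
        open ≡-Reasoning
        no-carry : ∀ F X K → F + X - (1ℤ + K) * (F + 1ℤ) ≡ X - K * (F + 1ℤ) - 1ℤ
        no-carry = ℤ.solve-∀
      ... | inj₂ e = inj₁ (begin
        f (x (suc k)) - + suc k * c          ≡⟨ cong (λ y → f y - + suc k * c) (x-suc k) ⟩
        f (s + x k) - + suc k * c            ≡⟨ cong (_- + suc k * c) e ⟩
        f s + f (x k) + 1ℤ - + suc k * c     ≡⟨ with-carry (f s) (f (x k)) (+ k) ⟩
        h k                                  ∎)
        where
        open ≡-Reasoning
        with-carry : ∀ F X K → F + X + 1ℤ - (1ℤ + K) * (F + 1ℤ) ≡ X - K * (F + 1ℤ)
        with-carry = ℤ.solve-∀

      x-+L : ∀ k → x (k ℕ.+ L) ≡ + L * s + x k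
      x-+L k = shift i (+ B) (+ k) (+ L) s
        where
        shift : ∀ i b k l s → i + (b + (k + l)) * s ≡ l * s + (i + (b + k) * s)
        shift = ℤ.solve-∀

      h-drop : ∀ k → h (k ℕ.+ L) + 1ℤ ℤ.≤ h k
      h-drop k = begin
        h (k ℕ.+ L) + 1ℤ                                  ≡⟨ cong (λ y → f y - + (k ℕ.+ L) * c + 1ℤ) (x-+L k) ⟩
        f (+ L * s + x k) - + (k ℕ.+ L) * c + 1ℤ          ≡⟨ ℤ.+-assoc (f (+ L * s + x k)) _ 1ℤ ⟩
        f (+ L * s + x k) + R                              ≤⟨ ℤ.+-monoˡ-≤ R (carry-≤ (+ L * s) (x k)) ⟩
        f (+ L * s) + f (x k) + 1ℤ + R                     ≤⟨ ℤ.+-monoˡ-≤ R (ℤ.+-monoˡ-≤ 1ℤ (ℤ.+-monoˡ-≤ (f (x k)) (proj₂ (gap s)))) ⟩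
        + L * c - + 2 + f (x k) + 1ℤ + R                   ≡⟨ cancel (+ L) c (f (x k)) (+ k) ⟩
        h k                                                ∎
        where
        open ℤ.≤-Reasoning
        R = - (+ (k ℕ.+ L) * c) + 1ℤ
        cancel : ∀ l c X k → l * c - + 2 + X + 1ℤ + (- ((k + l) * c) + 1ℤ) ≡ X - k * c
        cancel = ℤ.solve-∀

      r = (h 0 - j) %ℕ n

      h[nL]≤h0-r : h (n ℕ.* L) ℤ.≤ h 0 - + r
      h[nL]≤h0-r = begin
        h (n ℕ.* L)                    ≡⟨ [a+b]-b≡a (h (n ℕ.* L)) (+ n) ⟨
        h (n ℕ.* L) + + n - + n        ≤⟨ ℤ.+-monoˡ-≤ (- + n) (periodic-descent h L h-drop n) ⟩
        h 0 - + n                      ≤⟨ ℤ.+-monoʳ-≤ (h 0) (ℤ.neg-mono-≤ (ℤ.+≤+ (ℕ.<⇒≤ (n%ℕd<d (h 0 - j) n)))) ⟩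
        h 0 - + r                      ∎
        where
        open ℤ.≤-Reasoning
        [a+b]-b≡a : ∀ a b → a + b - b ≡ a
        [a+b]-b≡a = ℤ.solve-∀

      hit : ∃ λ y → N ℕ.< ∣ y ∣ × + m ∣ₛ y - i × + n ∣ₛ f y - j
      hit =
        let k , hk≡h0-r = intermediate-value h h-step (n ℕ.* L) h[nL]≤h0-r (ℤ.i-j≤i (h 0) (+ r))
        in x k , N<∣i+t*s∣ N i (B ℕ.+ k) s s≢0 (ℕ.<-≤-trans (ℕ.n<1+n _) (ℕ.m≤m+n B k)) ,
           subst (+ m ∣ₛ_) (sym ([i+j]-i≡j i _)) (Signed.∣n⇒∣m*n (+ (B ℕ.+ k)) m∣s) ,
           subst (+ n ∣ₛ_) (f[xk]-j k hk≡h0-r)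
             (Signed.∣m∣n⇒∣m+n (∣-[a-a%ℕn] (h 0 - j) n) (Signed.∣n⇒∣m*n (+ k) n∣c))
        where
        f[xk]-j : ∀ k → h k ≡ h 0 - + r → h 0 - j - + r + + k * c ≡ f (x k) - j
        f[xk]-j k hk≡h0-r = begin
          h 0 - j - + r + + k * c          ≡⟨ swap (h 0) j (+ r) (+ k * c) ⟩
          h 0 - + r - j + + k * c          ≡⟨ cong (λ w → w - j + + k * c) hk≡h0-r ⟨
          f (x k) - + k * c - j + + k * c  ≡⟨ cancel (f (x k)) (+ k * c) j ⟩
          f (x k) - j                      ∎
          where
          open ≡-Reasoning
          swap : ∀ a j r t → a - j - r + t ≡ a - r - j + t
          swap = ℤ.solve-∀
          cancel : ∀ a t j → a - t - j + t ≡ a - j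
          cancel = ℤ.solve-∀

  hits-every-residue : ∀ m n .{{_ : ℕ.NonZero m}} .{{_ : ℕ.NonZero n}} (i j : ℤ) (N : ℕ) →
                       ∃ λ y → N ℕ.< ∣ y ∣ × + m ∣ₛ y - i × + n ∣ₛ f y - j
  hits-every-residue m n i j N =
    let s , s≢0 , m∣s , n∣fs+1 = step-exists m n in Walk.hit m n i j N s≢0 m∣s n∣fs+1

mainTheorem2 : (α : ℝ) → Transcendental α →
    (f : ℤ → ℤ) → (∀ x → IsFloor α x (f x)) →
    (m n : ℕ) → 0 ℕ.< m → 0 ℕ.< n → (i j : ℤ) →
    ∀ (N : ℕ) → ∃ λ x → N ℕ.< ∣ x ∣ × (+ m ∣ x - i) × (+ n ∣ f x - j)
mainTheorem2 α tr f isFloor m n 0<m 0<n i j N =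
  let x , N<∣x∣ , m∣x-i , n∣fx-j = hits-every-residue m n {{ℕ.>-nonZero 0<m}} {{ℕ.>-nonZero 0<n}} i j N
  in x , N<∣x∣ , ∣⇒∣ᵤ m∣x-i , ∣⇒∣ᵤ n∣fx-j
  where
  open Floor tr {f} isFloor
  open Residues {f} floor-carry floor-odd floor-gap
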